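{- Let $I$ be a finite set of integers with $|I|\geq 8$. Then there are positive integers $q$ and $s$ such that \[|I|^{1/3}/8\leq |I(q;s)|\leq q^{1/2}.\]
   Context: For a set $I\subseteq\mathbb{Z}$, a positive integer $q$ and an integer $s$, $I(q;s)=\{k\in I:k\equiv s\pmod q\}$. -}

module Defs where

open import Data.Nat using (ℕ)
open import Data.Integer using (ℤ; +_; _-_)
open import Data.Integer.Divisibility.Signed using (_∣_; _∣?_)
open import Data.List using (List; filter; length)

_≡_[mod_] : ℤ → ℤ → ℕ → Set
k ≡ s [mod q ] = (+ q) ∣ (k - s)

-- I(q;s) = { k ∈ I : k ≡ s (mod q) }, for a finite set I given as a
-- duplicate-free list of integers
residueClass : List ℤ → ℕ → ℤ → List ℤ
residueClass I q s = filter (λ k → (+ q) ∣? (k - s)) I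

{-# OPTIONS --safe #-}
-- Start with the class I(1;1) = I and repeatedly double the modulus: the class of s
-- modulo q splits into the classes of s and s + q modulo 2q, and we keep the larger one.
-- Its size c at least halves while q doubles, so |I| ≤ c q persists, and we continue as
-- long as the class is too large, q < c². Once the new class c′ satisfies c′² ≤ 2q we
-- stop, with |I| ≤ c q < c³ ≤ 8 c′³. Since q < c² ≤ |I|², this happens after fewer
-- than |I|² steps.
module Submission where

open import Defs
open import Data.Nat using (ℕ; _≤_; _*_; _^_; NonZero)
open import Data.Integer using (ℤ; +_)
open import Data.List using (List; length)
open import Data.List.Relation.Unary.Unique.Propositional using (Unique)
open import Data.Product using (Σ; _×_)

open import Data.Nat using (zero; suc; _+_; _<_; s≤s; z≤n; >-nonZero⁻¹)
open import Data.Nat.Properties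
open import Data.Nat.Tactic.RingSolver as ℕ-Solver using ()
open import Data.Integer as ℤ using (_-_)
import Data.Integer.Properties as ℤ
open import Data.Integer.DivMod using (_%ℕ_; _/ℕ_; a≡a%ℕn+[a/ℕn]*n; n%ℕd<d)
open import Data.Integer.Divisibility.Signed using (divides)
open import Data.Integer.Tactic.RingSolver using (solve-∀)
open import Data.List using ([]; _∷_; filter)
open import Data.List.Properties using (length-filter; filter-all)
open import Data.List.Relation.Unary.All using (universal)
open import Data.Product using (_,_)
open import Data.Sum using (_⊎_; inj₁; inj₂; [_,_]; [_,_]′)
open import Function using (id)
open import Data.Empty using (⊥-elim)
open import Relation.Binary.PropositionalEquality hiding ([_])
open import Relation.Nullary using (Dec; yes; no)
open import Relation.Unary using (Pred; Decidable)

≡-mod-one : ∀ k s → k ≡ s [mod 1 ]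
≡-mod-one k s = divides (k - s) (sym (ℤ.*-identityʳ (k - s)))

≡-mod-double : ∀ {k s q} → k ≡ s [mod q ] →
  k ≡ s [mod 2 * q ] ⊎ k ≡ s ℤ.+ + q [mod 2 * q ]
≡-mod-double {k} {s} {q} (divides t k-s≡tq)
  with t %ℕ 2 | a≡a%ℕn+[a/ℕn]*n t 2 | n%ℕd<d t 2
... | 0 | t≡ | _ = inj₁ (divides (t /ℕ 2) (begin
  k - s                      ≡⟨ k-s≡tq ⟩
  t ℤ.* + q                  ≡⟨ cong (ℤ._* + q) t≡ ⟩
  (+ 0 ℤ.+ t /ℕ 2 ℤ.* + 2) ℤ.* + q ≡⟨ even (t /ℕ 2) (+ q) ⟩
  t /ℕ 2 ℤ.* (+ 2 ℤ.* + q)   ≡⟨ cong (t /ℕ 2 ℤ.*_) (ℤ.pos-* 2 q) ⟨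
  t /ℕ 2 ℤ.* + (2 * q)       ∎))
  where
  open ≡-Reasoning
  even : ∀ u p → (+ 0 ℤ.+ u ℤ.* + 2) ℤ.* p ≡ u ℤ.* (+ 2 ℤ.* p)
  even = solve-∀
... | 1 | t≡ | _ = inj₂ (divides (t /ℕ 2) (begin
  k - (s ℤ.+ + q)            ≡⟨ shift k s (+ q) ⟩
  (k - s) - + q              ≡⟨ cong (_- + q) k-s≡tq ⟩
  t ℤ.* + q - + q            ≡⟨ cong (λ u → u ℤ.* + q - + q) t≡ ⟩
  (+ 1 ℤ.+ t /ℕ 2 ℤ.* + 2) ℤ.* + q - + q ≡⟨ odd (t /ℕ 2) (+ q) ⟩
  t /ℕ 2 ℤ.* (+ 2 ℤ.* + q)   ≡⟨ cong (t /ℕ 2 ℤ.*_) (ℤ.pos-* 2 q) ⟨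
  t /ℕ 2 ℤ.* + (2 * q)       ∎))
  where
  open ≡-Reasoning
  shift : ∀ k s p → k - (s ℤ.+ p) ≡ (k - s) - p
  shift = solve-∀
  odd : ∀ u p → (+ 1 ℤ.+ u ℤ.* + 2) ℤ.* p - p ≡ u ℤ.* (+ 2 ℤ.* p)
  odd = solve-∀
... | suc (suc _) | _ | s≤s (s≤s ())

length-filter-∷ : ∀ {a p} {A : Set a} {P : Pred A p} (P? : Decidable P) x xs →
  length (filter P? xs) ≤ length (filter P? (x ∷ xs))
length-filter-∷ P? x xs with P? x
... | yes _ = n≤1+n _
... | no  _ = ≤-refl

module _ {a p q r} {A : Set a} {P : Pred A p} {Q : Pred A q} {R : Pred A r}
         (P? : Decidable P) (Q? : Decidable Q) (R? : Decidable R)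
         (P⊆Q∪R : ∀ {x} → P x → Q x ⊎ R x) where

  length-filter-⊆-∪ : ∀ xs →
    length (filter P? xs) ≤ length (filter Q? xs) + length (filter R? xs)
  length-filter-⊆-∪ [] = z≤n
  length-filter-⊆-∪ (x ∷ xs) with ih ← length-filter-⊆-∪ xs | P? x
  ... | no _ = ≤-trans ih (+-mono-≤ (length-filter-∷ Q? x xs) (length-filter-∷ R? x xs))
  ... | yes px with Q? x
  ...   | yes _ = s≤s (≤-trans ih (+-monoʳ-≤ _ (length-filter-∷ R? x xs)))
  ...   | no ¬qx with R? x
  ...     | yes _  = ≤-trans (s≤s ih) (≤-reflexive (sym (+-suc _ _)))
  ...     | no ¬rx = ⊥-elim ([ ¬qx , ¬rx ] (P⊆Q∪R px))

m+n≤2*m : ∀ {m n} → n ≤ m → m + n ≤ 2 * m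
m+n≤2*m {m} {n} n≤m = subst (m + n ≤_) (cong (_+_ m) (sym (+-identityʳ m))) (+-monoʳ-≤ m n≤m)

1+m+n≤m+2*n : ∀ m n → .{{NonZero n}} → suc m + n ≤ m + 2 * n
1+m+n≤m+2*n m n = begin
  suc m + n    ≡⟨ +-suc m n ⟨
  m + suc n    ≡⟨ cong (_+_ m) (+-comm 1 n) ⟩
  m + (n + 1)  ≤⟨ +-monoʳ-≤ m (m+n≤2*m (>-nonZero⁻¹ n)) ⟩
  m + 2 * n    ∎
  where open ≤-Reasoning

cube-bound : ∀ {n c q c′} → n ≤ c * q → q < c ^ 2 → c ≤ 2 * c′ → n ≤ 8 * c′ ^ 3
cube-bound {n} {c} {q} {c′} n≤cq q<c² c≤2c′ = begin
  n                   ≤⟨ n≤cq ⟩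
  c * q               ≤⟨ *-monoʳ-≤ c (<⇒≤ q<c²) ⟩
  c * c ^ 2           ≤⟨ *-mono-≤ c≤2c′ (^-monoˡ-≤ 2 c≤2c′) ⟩
  2 * c′ * (2 * c′) ^ 2 ≡⟨ cube-of-double c′ ⟩
  8 * c′ ^ 3          ∎
  where
  open ≤-Reasoning
  -- _^_ unfolded by hand: the ring solver does not recognise it
  cube-of-double : ∀ x → 2 * x * (2 * x * (2 * x * 1)) ≡ 8 * (x * (x * (x * 1)))
  cube-of-double = ℕ-Solver.solve-∀

module _ (I : List ℤ) where

  #class : ℕ → ℕ → ℕ
  #class q s = length (residueClass I q (+ s))

  #class-one : ∀ s → #class 1 s ≡ length I
  #class-one s = cong length (filter-all _ (universal (λ k → ≡-mod-one k (+ s)) I))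

  #class≤length : ∀ q s → #class q s ≤ length I
  #class≤length q s = length-filter _ I

  #class-split : ∀ q s → #class q s ≤ #class (2 * q) s + #class (2 * q) (s + q)
  #class-split q s = length-filter-⊆-∪ _ _ _ (λ {k} → ≡-mod-double {k} {+ s} {q}) I

  larger-half : ∀ q s → .{{NonZero s}} →
    Σ ℕ λ s′ → NonZero s′ × #class q s ≤ 2 * #class (2 * q) s′
  larger-half q s@(suc _) with #class (2 * q) (s + q) ≤? #class (2 * q) s
  ... | yes ≤ = s , _ , ≤-trans (#class-split q s) (m+n≤2*m {#class (2 * q) s} ≤)
  ... | no ≰ = s + q , _ , ≤-trans (#class-split q s)
    (≤-trans (≤-reflexive (+-comm (#class (2 * q) s) _))
             (m+n≤2*m {#class (2 * q) (s + q)} (<⇒≤ (≰⇒> ≰))))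

  LargeSparseClass : Set
  LargeSparseClass = Σ ℕ λ q → Σ ℕ λ s → NonZero q × NonZero s ×
    (length I ≤ 512 * #class q s ^ 3 × #class q s ^ 2 ≤ q)

  record Crowded (q s : ℕ) : Set where
    constructor crowded
    field
      q≢0 : NonZero q
      s≢0 : NonZero s
      above-average : length I ≤ #class q s * q
      too-large : q < #class q s ^ 2

  crowded-one : 2 ≤ length I → Crowded 1 1
  crowded-one 2≤n = crowded _ _
    (≤-reflexive (trans (sym (*-identityʳ _)) (cong (_* 1) (sym (#class-one 1)))))
    (≤-trans (s≤s (s≤s z≤n)) (subst (λ c → 2 ^ 2 ≤ c ^ 2) (sym (#class-one 1)) (^-monoˡ-≤ 2 2≤n)))

  refine : ∀ {q s s′} → Crowded q s → NonZero s′ → #class q s ≤ 2 * #class (2 * q) s′ →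
    LargeSparseClass ⊎ Crowded (2 * q) s′
  refine {q} {s} {s′} (crowded q≢0 _ n≤cq q<c²) s′≢0 c≤2c′ = decide (c′ ^ 2 ≤? 2 * q)
    where
    c′ = #class (2 * q) s′
    decide : Dec (c′ ^ 2 ≤ 2 * q) → LargeSparseClass ⊎ Crowded (2 * q) s′
    decide (yes sparse) = inj₁ (2 * q , s′ , m*n≢0 2 q {{_}} {{q≢0}} , s′≢0 ,
      ≤-trans (cube-bound {c′ = c′} n≤cq q<c² c≤2c′) (*-monoˡ-≤ (c′ ^ 3) (m≤m+n 8 504)) ,
      sparse)
    decide (no dense) = inj₂ (crowded (m*n≢0 2 q {{_}} {{q≢0}}) s′≢0 n≤c′[2q] (≰⇒> dense))
      where
      open ≤-Reasoning
      n≤c′[2q] : length I ≤ c′ * (2 * q)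
      n≤c′[2q] = begin
        length I        ≤⟨ n≤cq ⟩
        #class q s * q  ≤⟨ *-monoˡ-≤ q c≤2c′ ⟩
        2 * c′ * q      ≡⟨ cong (_* q) (*-comm 2 c′) ⟩
        c′ * 2 * q      ≡⟨ *-assoc c′ 2 q ⟩
        c′ * (2 * q)    ∎

  descend : ∀ fuel q s → length I ^ 2 ≤ fuel + q → Crowded q s → LargeSparseClass
  descend zero q s n²≤q (crowded _ _ _ q<c²) = ⊥-elim (<-irrefl refl (begin-strict
    q                <⟨ q<c² ⟩
    #class q s ^ 2   ≤⟨ ^-monoˡ-≤ 2 (#class≤length q s) ⟩
    length I ^ 2     ≤⟨ n²≤q ⟩
    q                ∎))
    where open ≤-Reasoning
  descend (suc fuel) q s n²≤ cr@(crowded q≢0 s≢0 _ _) =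
    let s′ , s′≢0 , c≤2c′ = larger-half q s {{s≢0}} in
    [ id , descend fuel (2 * q) s′ (≤-trans n²≤ (1+m+n≤m+2*n fuel q {{q≢0}})) ]′
      (refine cr s′≢0 c≤2c′)

lemma3p6 : (I : List ℤ) → Unique I → 8 ≤ length I →
    Σ ℕ λ q → Σ ℕ λ s → NonZero q × NonZero s ×
    (length I ≤ 512 * length (residueClass I q (+ s)) ^ 3 ×
    length (residueClass I q (+ s)) ^ 2 ≤ q)
lemma3p6 I _ 8≤n =
  descend I (length I ^ 2) 1 1 (m≤m+n _ 1) (crowded-one I (≤-trans (s≤s (s≤s z≤n)) 8≤n))
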